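{- Let $\mathbf A$ be a $\mathsf V$-algebra; a nonempty lattice filter $F\subseteq A$ is a congruence filter if and only if it is open.
   Context: A $\mathsf V$-algebra is a Boolean algebra $(A,\wedge,\vee,\to,0,1)$ with a binary operation $\mathbin{\Box\!\!\rightarrow}$ satisfying $x\mathbin{\Box\!\!\rightarrow}x=1$; $((x\mathbin{\Box\!\!\rightarrow}y)\wedge(y\mathbin{\Box\!\!\rightarrow}x))\le((x\mathbin{\Box\!\!\rightarrow}z)\leftrightarrow(y\mathbin{\Box\!\!\rightarrow}z))$; $((x\vee y)\mathbin{\Box\!\!\rightarrow}x)\vee((x\vee y)\mathbin{\Box\!\!\rightarrow}y)\vee(((x\vee y)\mathbin{\Box\!\!\rightarrow}z)\leftrightarrow((x\mathbin{\Box\!\!\rightarrow}z)\wedge(y\mathbin{\Box\!\!\rightarrow}z)))=1$; $x\mathbin{\Box\!\!\rightarrow}(y\wedge z)=(x\mathbin{\Box\!\!\rightarrow}y)\wedge(x\mathbin{\Box\!\!\rightarrow}z)$. Define $\Box x:=\neg x\mathbin{\Box\!\!\rightarrow}x$. A nonempty lattice filter $F$ is open if $x\in F$ implies $\Box x\in F$. A congruence filter is a set of the form $\{a\in A:(a,1)\in\theta\}$ for a congruence $\theta$ of $\mathbf A$ (equivalently, a deductive filter of the logic $\mathbf{GV}$, whose equivalent algebraic semantics is the variety of $\mathsf V$-algebras). -}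

module Defs where

open import Level using (Level; _⊔_; suc)
open import Data.Product using (Σ; ∃; _×_; _,_)
open import Relation.Binary.Core using (Rel)
open import Relation.Binary.Structures using (IsEquivalence)
open import Relation.Unary using (Pred)
open import Function.Bundles using (_⇔_)
open import Algebra.Lattice.Bundles using (BooleanAlgebra)

record VAlgebra (c ℓ : Level) : Set (suc (c ⊔ ℓ)) where
  infixr 5 _□→_
  field
    boolean : BooleanAlgebra c ℓ
  open BooleanAlgebra boolean public

  _⇒_ : Carrier → Carrier → Carrier
  x ⇒ y = (¬ x) ∨ y

  _⟺_ : Carrier → Carrier → Carrier
  x ⟺ y = (x ⇒ y) ∧ (y ⇒ x)

  _≤_ : Carrier → Carrier → Set ℓ
  x ≤ y = (x ∧ y) ≈ x

  field
    _□→_ : Carrier → Carrier → Carrier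
    □→-cong : ∀ {x x' y y'} → x ≈ x' → y ≈ y' → (x □→ y) ≈ (x' □→ y')
    ax1 : ∀ x → (x □→ x) ≈ ⊤
    ax2 : ∀ x y z → ((x □→ y) ∧ (y □→ x)) ≤ ((x □→ z) ⟺ (y □→ z))
    ax3 : ∀ x y z →
      (((x ∨ y) □→ x) ∨ ((x ∨ y) □→ y)
        ∨ (((x ∨ y) □→ z) ⟺ ((x □→ z) ∧ (y □→ z)))) ≈ ⊤
    ax4 : ∀ x y z → (x □→ (y ∧ z)) ≈ ((x □→ y) ∧ (x □→ z))

  □_ : Carrier → Carrier
  □ x = (¬ x) □→ x

module _ {c ℓ : Level} (A : VAlgebra c ℓ) where
  open VAlgebra A

  record IsLatticeFilter {ℓF : Level} (F : Pred Carrier ℓF) : Set (c ⊔ ℓ ⊔ ℓF) where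
    field
      nonempty : ∃ λ a → F a
      upward   : ∀ {a b} → F a → a ≤ b → F b
      meet     : ∀ {a b} → F a → F b → F (a ∧ b)

  -- congruence of A (relative to the setoid equality _≈_): an equivalence
  -- relation containing _≈_ and compatible with all basic operations
  -- (⊤, ⊥ are constants; _⇒_ is derived from ¬_ and _∨_)
  record IsCongruence {ℓθ : Level} (θ : Rel Carrier ℓθ) : Set (c ⊔ ℓ ⊔ ℓθ) where
    field
      isEquivalence : IsEquivalence θ
      ≈⊆θ    : ∀ {a b} → a ≈ b → θ a b
      ∧-comp : ∀ {a a' b b'} → θ a a' → θ b b' → θ (a ∧ b) (a' ∧ b')
      ∨-comp : ∀ {a a' b b'} → θ a a' → θ b b' → θ (a ∨ b) (a' ∨ b')
      ¬-comp : ∀ {a a'} → θ a a' → θ (¬ a) (¬ a')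
      □→-comp : ∀ {a a' b b'} → θ a a' → θ b b' → θ (a □→ b) (a' □→ b')

  IsCongruenceFilter : {ℓF : Level} (ℓθ : Level) → Pred Carrier ℓF → Set (c ⊔ ℓ ⊔ ℓF ⊔ suc ℓθ)
  IsCongruenceFilter ℓθ F =
    Σ (Rel Carrier ℓθ) λ θ → IsCongruence θ × (∀ a → (F a ⇔ θ a ⊤))

  IsOpen : {ℓF : Level} → Pred Carrier ℓF → Set (c ⊔ ℓF)
  IsOpen F = ∀ {x} → F x → F (□ x)

-- For a congruence θ with x θ ⊤ we get □ x = ¬ x □→ x θ ¬ ⊤ □→ ⊤ = ⊤, so congruence
-- filters are open. Conversely, for an open filter F the relation "a ⟺ b ∈ F" is a
-- Boolean congruence whose class of ⊤ is F; it respects □→ because □ (a ⟺ a') entails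
-- (a □→ b) ⟺ (a' □→ b) by CSO, and □ (b ⟺ b') entails (a □→ b) ⟺ (a □→ b') by
-- normality. Both rest on the fact that □ q = ¬ q □→ q entails a □→ q for every a.
module Submission where

open import Defs
open import Data.Product using (_,_)
open import Function.Bundles using (_⇔_; mk⇔; Equivalence)
open import Relation.Unary using (Pred)
open import Relation.Binary.Core using (Rel)
open import Relation.Binary.Structures using (IsEquivalence)
open import Algebra.Lattice.Bundles using (BooleanAlgebra)
import Relation.Binary.Lattice.Bundles as OrderTheoretic
import Relation.Binary.Reasoning.Setoid as SetoidReasoning
import Algebra.Lattice.Properties.Lattice as LatticeProperties
import Algebra.Lattice.Properties.BooleanAlgebra as BooleanAlgebraProperties

-- Boolean reasoning in the entailment form "p ≤ x", with p as the context. _≤_, _⇒_ and _⟺_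
-- unfold exactly as in VAlgebra, so they replace those (adding fixities) in VEntailment.
module BooleanEntailment {c ℓ} (B : BooleanAlgebra c ℓ) where
  open BooleanAlgebra B
  open BooleanAlgebraProperties B using (∧-identityʳ; ∧-zeroˡ)
  private
    module O = OrderTheoretic.Lattice (LatticeProperties.∨-∧-orderTheoreticLattice lattice)

  infix  3 _≤_
  infixr 4 _⇒_
  infix  4 _⟺_

  _≤_ : Rel Carrier ℓ
  x ≤ y = x ∧ y ≈ x

  _⇒_ : Carrier → Carrier → Carrier
  x ⇒ y = ¬ x ∨ y

  _⟺_ : Carrier → Carrier → Carrier
  x ⟺ y = (x ⇒ y) ∧ (y ⇒ x)

  variable
    p q x x' y y' z : Carrier

  ≤-reflexive : x ≈ y → x ≤ y
  ≤-reflexive x≈y = sym (O.reflexive x≈y)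

  ≤-refl : x ≤ x
  ≤-refl = ≤-reflexive refl

  ≤-trans : x ≤ y → y ≤ z → x ≤ z
  ≤-trans x≤y y≤z = sym (O.trans (sym x≤y) (sym y≤z))

  ≤-antisym : x ≤ y → y ≤ x → x ≈ y
  ≤-antisym x≤y y≤x = O.antisym (sym x≤y) (sym y≤x)

  x∧y≤x : x ∧ y ≤ x
  x∧y≤x = sym (O.x∧y≤x _ _)

  x∧y≤y : x ∧ y ≤ y
  x∧y≤y = sym (O.x∧y≤y _ _)

  ∧-greatest : p ≤ x → p ≤ y → p ≤ x ∧ y
  ∧-greatest p≤x p≤y = sym (O.∧-greatest (sym p≤x) (sym p≤y))

  x≤x∨y : x ≤ x ∨ y
  x≤x∨y = sym (O.x≤x∨y _ _)

  y≤x∨y : y ≤ x ∨ y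
  y≤x∨y = sym (O.y≤x∨y _ _)

  ∨-least : x ≤ z → y ≤ z → x ∨ y ≤ z
  ∨-least x≤z y≤z = sym (O.∨-least (sym x≤z) (sym y≤z))

  x≤⊤ : x ≤ ⊤
  x≤⊤ = ∧-identityʳ _

  ⊥≤x : ⊥ ≤ x
  ⊥≤x = ∧-zeroˡ _

  ≈⊤⇒≤ : x ≈ ⊤ → p ≤ x
  ≈⊤⇒≤ x≈⊤ = ≤-trans x≤⊤ (≤-reflexive (sym x≈⊤))

  weakenˡ : p ≤ x → p ∧ q ≤ x
  weakenˡ = ≤-trans x∧y≤x

  weakenʳ : q ≤ x → p ∧ q ≤ x
  weakenʳ = ≤-trans x∧y≤y

  ∧-mono : x ≤ x' → y ≤ y' → x ∧ y ≤ x' ∧ y'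
  ∧-mono x≤x' y≤y' = ∧-greatest (≤-trans x∧y≤x x≤x') (≤-trans x∧y≤y y≤y')

  ∨-mono : x ≤ x' → y ≤ y' → x ∨ y ≤ x' ∨ y'
  ∨-mono x≤x' y≤y' = ∨-least (≤-trans x≤x' x≤x∨y) (≤-trans y≤y' y≤x∨y)

  ∨-elim : p ≤ x ∨ y → p ∧ x ≤ z → p ∧ y ≤ z → p ≤ z
  ∨-elim {p} {x} {y} p≤x∨y p∧x≤z p∧y≤z =
    ≤-trans (∧-greatest ≤-refl p≤x∨y)
      (≤-trans (≤-reflexive (∧-distribˡ-∨ p x y)) (∨-least p∧x≤z p∧y≤z))

  cut : p ∧ x ≤ y → p ∧ y ≤ z → p ∧ x ≤ z
  cut p∧x≤y p∧y≤z = ≤-trans (∧-greatest x∧y≤x p∧x≤y) p∧y≤z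

  explosion : p ≤ x → p ≤ ¬ x → p ≤ y
  explosion p≤x p≤¬x =
    ≤-trans (∧-greatest p≤x p≤¬x) (≤-trans (≤-reflexive (∧-complementʳ _)) ⊥≤x)

  excluded-middle : p ≤ ¬ x ∨ x
  excluded-middle = ≈⊤⇒≤ (∨-complementˡ _)

  contraposition : p ∧ y ≤ x → p ∧ ¬ x ≤ ¬ y
  contraposition p∧y≤x = ∨-elim excluded-middle x∧y≤y
    (explosion (≤-trans (∧-mono x∧y≤x ≤-refl) p∧y≤x) (weakenˡ x∧y≤y))

  ⇒-intro : p ∧ x ≤ y → p ≤ x ⇒ y
  ⇒-intro p∧x≤y = ∨-elim excluded-middle (weakenʳ x≤x∨y) (≤-trans p∧x≤y y≤x∨y)

  ⇒-elim : p ≤ x ⇒ y → p ≤ x → p ≤ y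
  ⇒-elim p≤x⇒y p≤x = ∨-elim p≤x⇒y (explosion (weakenˡ p≤x) x∧y≤y) x∧y≤y

  ⟺-intro : p ∧ x ≤ y → p ∧ y ≤ x → p ≤ x ⟺ y
  ⟺-intro p∧x≤y p∧y≤x = ∧-greatest (⇒-intro p∧x≤y) (⇒-intro p∧y≤x)

  ⟺-to : p ≤ x ⟺ y → p ≤ x → p ≤ y
  ⟺-to p≤x⟺y = ⇒-elim (≤-trans p≤x⟺y x∧y≤x)

  ⟺-from : p ≤ x ⟺ y → p ≤ y → p ≤ x
  ⟺-from p≤x⟺y = ⇒-elim (≤-trans p≤x⟺y x∧y≤y)

  ⟺-entailsʳ : p ≤ x ⟺ y → p ∧ x ≤ y
  ⟺-entailsʳ p≤x⟺y = ⟺-to (weakenˡ p≤x⟺y) x∧y≤y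

  ⟺-entailsˡ : p ≤ x ⟺ y → p ∧ y ≤ x
  ⟺-entailsˡ p≤x⟺y = ⟺-from (weakenˡ p≤x⟺y) x∧y≤y

  ⟺-reflexive : x ≈ y → p ≤ x ⟺ y
  ⟺-reflexive x≈y =
    ⟺-intro (≤-trans x∧y≤y (≤-reflexive x≈y)) (≤-trans x∧y≤y (≤-reflexive (sym x≈y)))

  ⟺-sym : p ≤ x ⟺ y → p ≤ y ⟺ x
  ⟺-sym p≤x⟺y = ⟺-intro (⟺-entailsˡ p≤x⟺y) (⟺-entailsʳ p≤x⟺y)

  ⟺-trans : p ≤ x ⟺ y → p ≤ y ⟺ z → p ≤ x ⟺ z
  ⟺-trans p≤x⟺y p≤y⟺z =
    ⟺-intro (cut (⟺-entailsʳ p≤x⟺y) (⟺-entailsʳ p≤y⟺z))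
            (cut (⟺-entailsˡ p≤y⟺z) (⟺-entailsˡ p≤x⟺y))

  ¬-⟺-cong : p ≤ x ⟺ x' → p ≤ ¬ x ⟺ ¬ x'
  ¬-⟺-cong p≤x⟺x' =
    ⟺-intro (contraposition (⟺-entailsˡ p≤x⟺x')) (contraposition (⟺-entailsʳ p≤x⟺x'))

  ∧-⊢-mono : p ∧ x ≤ x' → p ∧ y ≤ y' → p ∧ (x ∧ y) ≤ x' ∧ y'
  ∧-⊢-mono p∧x≤x' p∧y≤y' =
    ∧-greatest (≤-trans (∧-mono ≤-refl x∧y≤x) p∧x≤x') (≤-trans (∧-mono ≤-refl x∧y≤y) p∧y≤y')

  ∨-⊢-mono : p ∧ x ≤ x' → p ∧ y ≤ y' → p ∧ (x ∨ y) ≤ x' ∨ y'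
  ∨-⊢-mono p∧x≤x' p∧y≤y' = ≤-trans (≤-reflexive (∧-distribˡ-∨ _ _ _)) (∨-mono p∧x≤x' p∧y≤y')

  ∧-⟺-cong : p ≤ x ⟺ x' → p ≤ y ⟺ y' → p ≤ x ∧ y ⟺ x' ∧ y'
  ∧-⟺-cong p≤x⟺x' p≤y⟺y' =
    ⟺-intro (∧-⊢-mono (⟺-entailsʳ p≤x⟺x') (⟺-entailsʳ p≤y⟺y'))
            (∧-⊢-mono (⟺-entailsˡ p≤x⟺x') (⟺-entailsˡ p≤y⟺y'))

  ∨-⟺-cong : p ≤ x ⟺ x' → p ≤ y ⟺ y' → p ≤ x ∨ y ⟺ x' ∨ y'
  ∨-⟺-cong p≤x⟺x' p≤y⟺y' =
    ⟺-intro (∨-⊢-mono (⟺-entailsʳ p≤x⟺x') (⟺-entailsʳ p≤y⟺y'))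
            (∨-⊢-mono (⟺-entailsˡ p≤x⟺x') (⟺-entailsˡ p≤y⟺y'))

  x≤x⟺⊤ : x ≤ x ⟺ ⊤
  x≤x⟺⊤ = ⟺-intro x≤⊤ x∧y≤x

  x⟺⊤≤x : x ⟺ ⊤ ≤ x
  x⟺⊤≤x = ⟺-from ≤-refl x≤⊤

  ¬x∨[y∧x]≈¬x∨y : ¬ x ∨ (y ∧ x) ≈ ¬ x ∨ y
  ¬x∨[y∧x]≈¬x∨y {x} {y} = begin
    ¬ x ∨ (y ∧ x)            ≈⟨ ∨-distribˡ-∧ (¬ x) y x ⟩
    (¬ x ∨ y) ∧ (¬ x ∨ x)    ≈⟨ ∧-cong refl (∨-complementˡ x) ⟩
    (¬ x ∨ y) ∧ ⊤            ≈⟨ ∧-identityʳ (¬ x ∨ y) ⟩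
    ¬ x ∨ y                  ∎
    where open SetoidReasoning setoid

-- Rules of Lewis's conditional logic (ID, CC, RW, K, CSO, CA) in entailment form.
module VEntailment {c ℓ} (A : VAlgebra c ℓ) where
  open VAlgebra A hiding (_≤_; _⇒_; _⟺_)
  open BooleanEntailment boolean public

  variable
    a a' b b' : Carrier

  □→-ID : p ≤ x □→ x
  □→-ID = ≈⊤⇒≤ (ax1 _)

  □→-CC : p ≤ x □→ y → p ≤ x □→ z → p ≤ x □→ y ∧ z
  □→-CC {x = x} {y} {z} p≤x□→y p≤x□→z =
    ≤-trans (∧-greatest p≤x□→y p≤x□→z) (≤-reflexive (sym (ax4 x y z)))

  □→-RW : p ≤ x □→ y → y ≤ z → p ≤ x □→ z
  □→-RW {x = x} {y} {z} p≤x□→y y≤z =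
    ≤-trans p≤x□→y (≤-trans (≤-reflexive (trans (□→-cong refl (sym y≤z)) (ax4 x y z))) x∧y≤y)

  □→-K : p ≤ x □→ q → p ≤ x □→ y → q ∧ y ≤ z → p ≤ x □→ z
  □→-K p≤x□→q p≤x□→y q∧y≤z = □→-RW (□→-CC p≤x□→q p≤x□→y) q∧y≤z

  □→-substˡ : x ≈ x' → p ≤ x □→ z → p ≤ x' □→ z
  □→-substˡ x≈x' p≤x□→z = ≤-trans p≤x□→z (≤-reflexive (□→-cong x≈x' refl))

  □→-CSO : p ≤ x □→ y → p ≤ y □→ x → p ≤ x □→ z → p ≤ y □→ z
  □→-CSO {x = x} {y} {z} p≤x□→y p≤y□→x =
    ⟺-to (≤-trans (∧-greatest p≤x□→y p≤y□→x) (ax2 x y z))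

  -- ax3 gives CA only up to a case split; in its first two cases CSO moves
  -- x □→ z (resp. y □→ z) to the antecedent x ∨ y.
  □→-CA : p ≤ x □→ z → p ≤ y □→ z → p ≤ x ∨ y □→ z
  □→-CA {x = x} {z} {y} p≤x□→z p≤y□→z =
    ∨-elim (≈⊤⇒≤ (ax3 x y z))
      (□→-CSO (□→-RW □→-ID x≤x∨y) x∧y≤y (weakenˡ p≤x□→z))
      (∨-elim x∧y≤y
        (□→-CSO (□→-RW □→-ID y≤x∨y) x∧y≤y (weakenˡ (weakenˡ p≤y□→z)))
        (⟺-from x∧y≤y (∧-greatest (weakenˡ (weakenˡ p≤x□→z)) (weakenˡ (weakenˡ p≤y□→z)))))

  x□→⊤≈⊤ : x □→ ⊤ ≈ ⊤
  x□→⊤≈⊤ = ≤-antisym x≤⊤ (□→-RW □→-ID x≤⊤)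

  -- □ q makes ¬ q a vacuous antecedent, so by CA both a and q follow from ¬ q ∨ a
  -- (the latter via ¬ q ∨ a ≈ ¬ q ∨ (a ∧ q)); CSO then replaces ¬ q ∨ a by a.
  □⇒□→ : p ≤ □ q → p ≤ a □→ q
  □⇒□→ {p} {q} {a} p≤□q = □→-CSO ¬q∨a□→a a□→¬q∨a ¬q∨a□→q
    where
    ¬q□→any : ∀ w → p ≤ ¬ q □→ w
    ¬q□→any w = □→-K p≤□q □→-ID (explosion x∧y≤x x∧y≤y)

    ¬q∨a□→a : p ≤ ¬ q ∨ a □→ a
    ¬q∨a□→a = □→-CA (¬q□→any a) □→-ID

    a□→¬q∨a : p ≤ a □→ ¬ q ∨ a
    a□→¬q∨a = □→-RW □→-ID y≤x∨y

    ¬q∨a□→q : p ≤ ¬ q ∨ a □→ q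
    ¬q∨a□→q = □→-substˡ ¬x∨[y∧x]≈¬x∨y (□→-RW (□→-CA (¬q□→any (a ∧ q)) □→-ID) x∧y≤y)

  □→-congˡ : p ≤ □ (a ⟺ a') → p ≤ (a □→ b) ⟺ (a' □→ b)
  □→-congˡ {a = a} {a'} {b} p≤□[a⟺a'] =
    ≤-trans (∧-greatest (□→-K (□⇒□→ p≤□[a⟺a']) □→-ID (⟺-entailsʳ ≤-refl))
                        (□→-K (□⇒□→ p≤□[a⟺a']) □→-ID (⟺-entailsˡ ≤-refl)))
            (ax2 a a' b)

  □→-congʳ : p ≤ □ (b ⟺ b') → p ≤ (a □→ b) ⟺ (a □→ b')
  □→-congʳ p≤□[b⟺b'] =
    ⟺-intro (□→-K (weakenˡ (□⇒□→ p≤□[b⟺b'])) x∧y≤y (⟺-entailsʳ ≤-refl))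
            (□→-K (weakenˡ (□⇒□→ p≤□[b⟺b'])) x∧y≤y (⟺-entailsˡ ≤-refl))

  □→-⟺-cong : p ≤ □ (a ⟺ a') → p ≤ □ (b ⟺ b') → p ≤ (a □→ b) ⟺ (a' □→ b')
  □→-⟺-cong p≤□[a⟺a'] p≤□[b⟺b'] = ⟺-trans (□→-congʳ p≤□[b⟺b']) (□→-congˡ p≤□[a⟺a'])

module _ {c ℓ ℓF} (A : VAlgebra c ℓ) (F : Pred (VAlgebra.Carrier A) ℓF) where
  open VAlgebra A hiding (_≤_; _⇒_; _⟺_)
  open VEntailment A

  congruenceFilter⇒open : ∀ {ℓθ} → IsCongruenceFilter A ℓθ F → IsOpen A F
  congruenceFilter⇒open (θ , θ-isCongruence , F⇔θ⊤) {x} Fx =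
    Equivalence.from (F⇔θ⊤ (□ x)) (θ.trans (□→-comp (¬-comp xθ⊤) xθ⊤) (≈⊆θ x□→⊤≈⊤))
    where
    open IsCongruence θ-isCongruence using (≈⊆θ; ¬-comp; □→-comp)
    module θ = IsEquivalence (IsCongruence.isEquivalence θ-isCongruence)
    xθ⊤ : θ x ⊤
    xθ⊤ = Equivalence.to (F⇔θ⊤ x) Fx

  module _ (F-isFilter : IsLatticeFilter A F) where
    open IsLatticeFilter F-isFilter

    F⊤ : F ⊤
    F⊤ = let (a , Fa) = nonempty in upward Fa x≤⊤

    F-closed : (∀ {p} → p ≤ x → p ≤ y → p ≤ z) → F x → F y → F z
    F-closed rule Fx Fy = upward (meet Fx Fy) (rule x∧y≤x x∧y≤y)

    _≡F_ : Rel Carrier ℓF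
    a ≡F b = F (a ⟺ b)

    ≡F-isCongruence : IsOpen A F → IsCongruence A _≡F_
    ≡F-isCongruence F-isOpen = record
      { isEquivalence = record
        { refl  = upward F⊤ (⟺-reflexive refl)
        ; sym   = λ a≡b → upward a≡b (⟺-sym ≤-refl)
        ; trans = F-closed ⟺-trans
        }
      ; ≈⊆θ     = λ a≈b → upward F⊤ (⟺-reflexive a≈b)
      ; ∧-comp  = F-closed ∧-⟺-cong
      ; ∨-comp  = F-closed ∨-⟺-cong
      ; ¬-comp  = λ a≡a' → upward a≡a' (¬-⟺-cong ≤-refl)
      ; □→-comp = λ a≡a' b≡b' → F-closed □→-⟺-cong (F-isOpen a≡a') (F-isOpen b≡b')
      }

    F⇔≡F⊤ : ∀ a → F a ⇔ a ≡F ⊤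
    F⇔≡F⊤ a = mk⇔ (λ Fa → upward Fa x≤x⟺⊤) (λ a≡⊤ → upward a≡⊤ x⟺⊤≤x)

    open⇒congruenceFilter : IsOpen A F → IsCongruenceFilter A ℓF F
    open⇒congruenceFilter F-isOpen = _≡F_ , ≡F-isCongruence F-isOpen , F⇔≡F⊤

proposition4p9 : ∀ {c ℓ ℓF} (A : VAlgebra c ℓ)
                 (F : Pred (VAlgebra.Carrier A) ℓF) →
                 IsLatticeFilter A F →
                 (IsCongruenceFilter A ℓF F ⇔ IsOpen A F)
proposition4p9 A F F-isFilter =
  mk⇔ (congruenceFilter⇒open A F) (open⇒congruenceFilter A F F-isFilter)
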